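{- Let $G$ be a computable subgroup of $S_\infty$. If $G$ has only finitely many actions, then $R^{ce}_G\le_c E^n_{set}$ for some $n$.
   Context: $(W_e)_{e\in\omega}$ is a standard uniform enumeration of the c.e.\ subsets of $\omega$. A computable subgroup of $S_\infty$ is a computable group acting computably by permutations on $\omega$; it has only finitely many actions if the set of permutations of $\omega$ induced by its elements is finite. $i\,R^{ce}_G\,j\iff(\exists\gamma\in G)(W_i=\{\gamma(x):x\in W_j\})$. Fix a computable $n$-ary pairing function $\langle\cdot,\ldots,\cdot\rangle$ (a computable bijection $\omega^n\to\omega$); $E^n_{set}$ is the equivalence relation on $\omega$ with $\langle i_0,\ldots,i_{n-1}\rangle\,E^n_{set}\,\langle j_0,\ldots,j_{n-1}\rangle\iff\{W_{i_k}:k<n\}=\{W_{j_k}:k<n\}$. $E\le_c F$ means there is a computable $f$ with $x\,E\,y\iff f(x)\,F\,f(y)$. -}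

module Defs where

open import Data.Nat using (ℕ; zero; suc; _+_; _*_; _<_; _%_; _/_)
open import Data.Bool using (Bool; true; false; if_then_else_)
open import Data.List using (List; []; _∷_)
open import Data.List.Relation.Unary.All using (All)
open import Data.List.Relation.Unary.Any using (Any)
open import Data.Vec using (Vec; []; _∷_; lookup)
open import Data.Fin using (Fin)
open import Data.Product using (Σ; ∃; _×_; _,_; proj₁; proj₂)
open import Relation.Binary.PropositionalEquality using (_≡_)

-- Cantor pairing, given through its inverse.
-- unpair enumerates ℕ×ℕ along antidiagonals:
-- (0,0),(1,0),(0,1),(2,0),(1,1),(0,2),...  i.e. unpair (tri (a+b) + b) = (a , b).

unpair : ℕ → ℕ × ℕ
unpair zero = 0 , 0
unpair (suc n) with unpair n
... | zero  , b = suc b , 0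
... | suc a , b = a , suc b

π₁ π₂ : ℕ → ℕ
π₁ n = proj₁ (unpair n)
π₂ n = proj₂ (unpair n)

unpairN : (n : ℕ) → ℕ → Vec ℕ n
unpairN zero          _ = []
unpairN (suc zero)    x = x ∷ []
unpairN (suc (suc n)) x = π₁ x ∷ unpairN (suc n) (π₂ x)

-- Kleene's μ-recursive functions (on argument lists; missing arguments
-- default to 0), with a relational big-step semantics.

data Code : Set where
  zer  : Code
  sucC : Code
  proj : ℕ → Code
  comp : Code → List Code → Code
  prec : Code → Code → Code
  mu   : Code → Code

hd : List ℕ → ℕ
hd []      = 0
hd (x ∷ _) = x

tl : List ℕ → List ℕ
tl []       = []
tl (_ ∷ xs) = xs

nth : List ℕ → ℕ → ℕ
nth []       _       = 0
nth (x ∷ _)  zero    = x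
nth (_ ∷ xs) (suc i) = nth xs i

mutual
  data Eval : Code → List ℕ → ℕ → Set where
    ezer  : ∀ xs → Eval zer xs 0
    esuc  : ∀ xs → Eval sucC xs (suc (hd xs))
    eproj : ∀ i xs → Eval (proj i) xs (nth xs i)
    ecomp : ∀ {f gs xs ys z} → EvalAll gs xs ys → Eval f ys z → Eval (comp f gs) xs z
    eprec0 : ∀ {f g xs z} → hd xs ≡ 0 → Eval f (tl xs) z → Eval (prec f g) xs z
    eprecS : ∀ {f g xs n r z} → hd xs ≡ suc n →
             Eval (prec f g) (n ∷ tl xs) r → Eval g (n ∷ r ∷ tl xs) z →
             Eval (prec f g) xs z
    emu   : ∀ {f xs y} → Eval f (y ∷ xs) 0 →
            (∀ k → k < y → Σ ℕ λ v → Eval f (k ∷ xs) (suc v)) →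
            Eval (mu f) xs y

  data EvalAll : List Code → List ℕ → List ℕ → Set where
    []  : ∀ {xs} → EvalAll [] xs []
    _∷_ : ∀ {g gs xs y ys} → Eval g xs y → EvalAll gs xs ys → EvalAll (g ∷ gs) xs (y ∷ ys)

-- Gödel numbering ℕ → Code (surjective, computable; fuel argument only
-- guarantees termination: components are strictly smaller than the number).

mutual
  decodeF : ℕ → ℕ → Code
  decodeF zero    _       = zer
  decodeF (suc f) zero    = zer
  decodeF (suc f) (suc m) = pick (m % 6) (m / 6)
    where
    pick : ℕ → ℕ → Code
    pick 0 p = sucC
    pick 1 p = proj p
    pick 2 p = comp (decodeF f (π₁ p)) (decodeLF f (π₂ p))
    pick 3 p = prec (decodeF f (π₁ p)) (decodeF f (π₂ p))
    pick 4 p = mu (decodeF f p)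
    pick _ p = zer

  decodeLF : ℕ → ℕ → List Code
  decodeLF zero    _       = []
  decodeLF (suc f) zero    = []
  decodeLF (suc f) (suc m) = decodeF f (π₁ m) ∷ decodeLF f (π₂ m)

decode : ℕ → Code
decode e = decodeF (suc e) e

_⟦_⟧↓_ : ℕ → ℕ → ℕ → Set
e ⟦ x ⟧↓ y = Eval (decode e) (x ∷ []) y

W : ℕ → ℕ → Set
W e x = ∃ λ y → e ⟦ x ⟧↓ y

Computable : (ℕ → ℕ) → Set
Computable f = ∃ λ e → ∀ x → e ⟦ x ⟧↓ f x

_⇔_ : Set → Set → Set
A ⇔ B = (A → B) × (B → A)

_≐_ : (ℕ → Set) → (ℕ → Set) → Set
A ≐ B = ∀ x → A x ⇔ B x

Rel : Set₁
Rel = ℕ → ℕ → Set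

_≤c_ : Rel → Rel → Set
E ≤c F = ∃ λ f → Computable f × (∀ x y → E x y ⇔ F (f x) (f y))

-- Computable subgroups of S_∞: a computable group (decidable domain
-- D ⊆ ω, computable multiplication and inversion) acting computably on ω
-- by permutations (a group action).

record CompGroupAction : Set where
  field
    D     : ℕ → Bool
    D-comp : Computable (λ n → if D n then 1 else 0)
    mul   : ℕ → ℕ → ℕ
    mul-comp : Computable (λ n → mul (π₁ n) (π₂ n))
    inv   : ℕ → ℕ
    inv-comp : Computable inv
    one   : ℕ
    one-D : D one ≡ true
    mul-D : ∀ g h → D g ≡ true → D h ≡ true → D (mul g h) ≡ true
    inv-D : ∀ g → D g ≡ true → D (inv g) ≡ true
    assoc : ∀ g h k → D g ≡ true → D h ≡ true → D k ≡ true →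
            mul (mul g h) k ≡ mul g (mul h k)
    idˡ   : ∀ g → D g ≡ true → mul one g ≡ g
    idʳ   : ∀ g → D g ≡ true → mul g one ≡ g
    invˡ  : ∀ g → D g ≡ true → mul (inv g) g ≡ one
    invʳ  : ∀ g → D g ≡ true → mul g (inv g) ≡ one
    act   : ℕ → ℕ → ℕ
    act-comp : Computable (λ n → act (π₁ n) (π₂ n))
    act-one : ∀ x → act one x ≡ x
    act-mul : ∀ g h x → D g ≡ true → D h ≡ true →
              act (mul g h) x ≡ act g (act h x)

open CompGroupAction public

image : CompGroupAction → ℕ → (ℕ → Set) → ℕ → Set
image G γ A y = ∃ λ x → A x × act G γ x ≡ y

FinitelyManyActions : CompGroupAction → Set
FinitelyManyActions G =
  ∃ λ (L : List ℕ) → All (λ h → D G h ≡ true) L ×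
    (∀ g → D G g ≡ true → Any (λ h → ∀ x → act G g x ≡ act G h x) L)

Rce : CompGroupAction → Rel
Rce G i j = ∃ λ γ → D G γ ≡ true × (W i ≐ image G γ (W j))

Eset : ℕ → Rel
Eset n a b =
  (∀ (k : Fin n) → ∃ λ (l : Fin n) → W (lookup (unpairN n a) k) ≐ W (lookup (unpairN n b) l)) ×
  (∀ (l : Fin n) → ∃ λ (k : Fin n) → W (lookup (unpairN n b) l) ≐ W (lookup (unpairN n a) k))

{-# OPTIONS --safe #-}
module Submission where

-- Let h₀ = 1, h₁, …, h_{n-1} be elements of G realising all of its actions. Since
-- h⁻¹ acts computably, an index of h[W_i] = {y : h⁻¹ y ∈ W_i} is computable from
-- i, and i is sent to the n-tuple of indices of h₀[W_i], …, h_{n-1}[W_i]. If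
-- W_i = γ[W_j], each h_k γ acts like some h_l, so h_k[W_i] = h_l[W_j]; with γ⁻¹
-- the converse inclusion follows, and the two families of sets coincide.
-- Conversely, if they coincide then W_i = h₀[W_i] = h_l[W_j] for some l.

open import Defs
open import Data.Nat
open import Data.Nat.Properties
open import Data.Nat.DivMod
open import Data.Nat.Divisibility using (n∣m*n)
open import Data.List using (List; []; _∷_; length)
import Data.List.Relation.Unary.All as List using (All)
import Data.List.Relation.Unary.Any as List using (Any)
open import Data.Vec using (Vec; []; _∷_; lookup; map; fromList)
open import Data.Vec.Properties using (lookup-map)
open import Data.Vec.Relation.Unary.All as All using (All; _∷_)
import Data.Vec.Relation.Unary.All.Properties as All
import Data.Vec.Relation.Unary.Any as Any
import Data.Vec.Relation.Unary.Any.Properties as Any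
open import Data.Fin using (Fin; zero; suc)
open import Data.Bool using (true)
open import Data.Product using (∃; _×_; _,_; proj₁; proj₂; swap)
open import Function using (_∘_; id)
open import Level using (0ℓ) renaming (suc to lsuc)
open import Relation.Nullary using (contradiction)
open import Relation.Nullary.Decidable using (True; toWitness)
open import Relation.Binary using (IsEquivalence; Setoid; tri<; tri≈; tri>)
import Relation.Binary.Reasoning.Setoid as SetoidReasoning
open import Relation.Binary.PropositionalEquality
  using (_≡_; _≗_; refl; sym; trans; cong; cong₂; subst; subst₂; module ≡-Reasoning)

mutual
  Eval-deterministic : ∀ {c xs y z} → Eval c xs y → Eval c xs z → y ≡ z
  Eval-deterministic (ezer _) (ezer _) = refl
  Eval-deterministic (esuc _) (esuc _) = refl
  Eval-deterministic (eproj _ _) (eproj _ _) = refl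
  Eval-deterministic (ecomp gs f) (ecomp gs′ f′) with EvalAll-deterministic gs gs′
  ... | refl = Eval-deterministic f f′
  Eval-deterministic (eprec0 _ f) (eprec0 _ f′) = Eval-deterministic f f′
  Eval-deterministic (eprec0 p _) (eprecS q _ _) = contradiction (trans (sym p) q) 0≢1+n
  Eval-deterministic (eprecS p _ _) (eprec0 q _) = contradiction (trans (sym q) p) 0≢1+n
  Eval-deterministic (eprecS p r g) (eprecS q r′ g′) with suc-injective (trans (sym p) q)
  ... | refl with Eval-deterministic r r′
  ... | refl = Eval-deterministic g g′
  Eval-deterministic {y = y} {z} (emu f[y]≡0 below-y) (emu f[z]≡0 below-z) with <-cmp y z
  ... | tri< y<z _ _ = contradiction (Eval-deterministic f[y]≡0 (proj₂ (below-z y y<z))) 0≢1+n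
  ... | tri≈ _ y≡z _ = y≡z
  ... | tri> _ _ z<y = contradiction (Eval-deterministic (proj₂ (below-y z z<y)) f[z]≡0) 1+n≢0

  EvalAll-deterministic : ∀ {gs xs ys zs} → EvalAll gs xs ys → EvalAll gs xs zs → ys ≡ zs
  EvalAll-deterministic [] [] = refl
  EvalAll-deterministic (g ∷ gs) (g′ ∷ gs′) =
    cong₂ _∷_ (Eval-deterministic g g′) (EvalAll-deterministic gs gs′)

tri : ℕ → ℕ
tri zero    = zero
tri (suc k) = suc k + tri k

pair : ℕ → ℕ → ℕ
pair a b = tri (a + b) + b

unpair-suc-of-zero : ∀ n {b} → unpair n ≡ (0 , b) → unpair (suc n) ≡ (suc b , 0)
unpair-suc-of-zero _ eq rewrite eq = refl

unpair-suc-of-suc : ∀ n {a b} → unpair n ≡ (suc a , b) → unpair (suc n) ≡ (a , suc b)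
unpair-suc-of-suc _ eq rewrite eq = refl

unpair-tri+ : ∀ {d b} → b ≤ d → unpair (tri d + b) ≡ (d ∸ b , b)
unpair-tri+ {zero} {zero} z≤n = refl
unpair-tri+ {suc d} {zero} z≤n = begin
  unpair (tri (suc d) + 0)  ≡⟨ cong unpair (trans (+-identityʳ _) (cong suc (+-comm d (tri d)))) ⟩
  unpair (suc (tri d + d))  ≡⟨ unpair-suc-of-zero (tri d + d)
                                 (trans (unpair-tri+ {d} ≤-refl) (cong (_, d) (n∸n≡0 d))) ⟩
  (suc d , 0)               ∎
  where open ≡-Reasoning
unpair-tri+ {suc d} {suc b} (s≤s b≤d) = begin
  unpair (tri (suc d) + suc b)    ≡⟨ cong unpair (+-suc (tri (suc d)) b) ⟩
  unpair (suc (tri (suc d) + b))  ≡⟨ unpair-suc-of-suc (tri (suc d) + b)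
                                       (trans (unpair-tri+ {suc d} (m≤n⇒m≤1+n b≤d))
                                              (cong (_, b) (+-∸-assoc 1 b≤d))) ⟩
  (d ∸ b , suc b)                 ∎
  where open ≡-Reasoning

unpair-pair : ∀ a b → unpair (pair a b) ≡ (a , b)
unpair-pair a b = trans (unpair-tri+ (m≤n+m b a)) (cong (_, b) (m+n∸n≡m a b))

π₁-pair : ∀ a b → π₁ (pair a b) ≡ a
π₁-pair a b = cong proj₁ (unpair-pair a b)

π₂-pair : ∀ a b → π₂ (pair a b) ≡ b
π₂-pair a b = cong proj₂ (unpair-pair a b)

π₁[n]+π₂[n]≤n : ∀ n → π₁ n + π₂ n ≤ n
π₁[n]+π₂[n]≤n zero = z≤n
π₁[n]+π₂[n]≤n (suc n) with unpair n | π₁[n]+π₂[n]≤n n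
... | zero  , b | b≤n = s≤s (subst (_≤ n) (sym (+-identityʳ b)) b≤n)
... | suc a , b | a+b<n = subst (_≤ suc n) (sym (+-suc a b)) (m≤n⇒m≤1+n a+b<n)

π₁[n]≤n : ∀ n → π₁ n ≤ n
π₁[n]≤n n = ≤-trans (m≤m+n _ _) (π₁[n]+π₂[n]≤n n)

π₂[n]≤n : ∀ n → π₂ n ≤ n
π₂[n]≤n n = ≤-trans (m≤n+m _ _) (π₁[n]+π₂[n]≤n n)

n≤tri[n] : ∀ n → n ≤ tri n
n≤tri[n] zero    = z≤n
n≤tri[n] (suc n) = m≤m+n (suc n) (tri n)

a≤pair[a,b] : ∀ a b → a ≤ pair a b
a≤pair[a,b] a b = ≤-trans (m≤m+n a b) (≤-trans (n≤tri[n] (a + b)) (m≤m+n _ b))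

b≤pair[a,b] : ∀ a b → b ≤ pair a b
b≤pair[a,b] a b = m≤n+m b _

tuple : ∀ {n} → Vec ℕ n → ℕ
tuple []           = 0
tuple (x ∷ [])     = x
tuple (x ∷ y ∷ ys) = pair x (tuple (y ∷ ys))

lookup-unpairN-tuple : ∀ {n} (xs : Vec ℕ n) k →
                       lookup (unpairN n (tuple xs)) k ≡ lookup xs k
lookup-unpairN-tuple (x ∷ [])     zero    = refl
lookup-unpairN-tuple (x ∷ y ∷ ys) zero    = π₁-pair x (tuple (y ∷ ys))
lookup-unpairN-tuple (x ∷ y ∷ ys) (suc k) =
  trans (cong (λ t → lookup (unpairN _ t) k) (π₂-pair x (tuple (y ∷ ys))))
        (lookup-unpairN-tuple (y ∷ ys) k)

tagged : ℕ → ℕ → ℕ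
tagged k p = suc (k + p * 6)

%-tagged : ∀ k p {k<6 : True (k <? 6)} → (k + p * 6) % 6 ≡ k
%-tagged k p {k<6} = trans ([m+kn]%n≡m%n k p 6) (m<n⇒m%n≡m (toWitness k<6))

/-tagged : ∀ k p {k<6 : True (k <? 6)} → (k + p * 6) / 6 ≡ p
/-tagged k p {k<6} =
  trans (+-distrib-/-∣ʳ k (n∣m*n p)) (cong₂ _+_ (m<n⇒m/n≡0 (toWitness k<6)) (m*n/n≡m p 6))

decodeF-proj : ∀ f i → decodeF (suc f) (tagged 1 i) ≡ proj i
decodeF-proj f i rewrite %-tagged 1 i {_} | /-tagged 1 i {_} = refl

decodeF-comp : ∀ f a b →
               decodeF (suc f) (tagged 2 (pair a b)) ≡ comp (decodeF f a) (decodeLF f b)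
decodeF-comp f a b rewrite %-tagged 2 (pair a b) {_} | /-tagged 2 (pair a b) {_}
                         | π₁-pair a b | π₂-pair a b = refl

decodeF-prec : ∀ f a b →
               decodeF (suc f) (tagged 3 (pair a b)) ≡ prec (decodeF f a) (decodeF f b)
decodeF-prec f a b rewrite %-tagged 3 (pair a b) {_} | /-tagged 3 (pair a b) {_}
                         | π₁-pair a b | π₂-pair a b = refl

decodeF-mu : ∀ f a → decodeF (suc f) (tagged 4 a) ≡ mu (decodeF f a)
decodeF-mu f a rewrite %-tagged 4 a {_} | /-tagged 4 a {_} = refl

decodeLF-cons : ∀ f a b → decodeLF (suc f) (suc (pair a b)) ≡ decodeF f a ∷ decodeLF f b
decodeLF-cons f a b rewrite π₁-pair a b | π₂-pair a b = refl

payload<fuel : ∀ k {p x f} → x ≤ p → tagged k p < suc f → x < f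
payload<fuel k {p} x≤p (s≤s tagged≤f) = ≤-<-trans x≤p (<-≤-trans p<tagged tagged≤f)
  where
  p<tagged : p < tagged k p
  p<tagged = s≤s (≤-trans (m≤m*n p 6) (m≤n+m _ k))

π₁<fuel : ∀ {d m f} → d ≤ m → m < f → π₁ d < f
π₁<fuel {d} d≤m = ≤-<-trans (≤-trans (π₁[n]≤n d) d≤m)

π₂<fuel : ∀ {d m f} → d ≤ m → m < f → π₂ d < f
π₂<fuel {d} d≤m = ≤-<-trans (≤-trans (π₂[n]≤n d) d≤m)

mutual
  decodeF-fuel : ∀ {f g x} → x < f → x < g → decodeF f x ≡ decodeF g x
  decodeF-fuel {suc f} {suc g} {zero} _ _ = refl
  decodeF-fuel {suc f} {suc g} {suc m} (s≤s m<f) (s≤s m<g) with m % 6 | m / 6 | m/n≤m m 6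
  ... | 0 | _ | _ = refl
  ... | 1 | _ | _ = refl
  ... | 2 | d | d≤m = cong₂ comp (decodeF-fuel (π₁<fuel d≤m m<f) (π₁<fuel d≤m m<g))
                                 (decodeLF-fuel (π₂<fuel d≤m m<f) (π₂<fuel d≤m m<g))
  ... | 3 | d | d≤m = cong₂ prec (decodeF-fuel (π₁<fuel d≤m m<f) (π₁<fuel d≤m m<g))
                                 (decodeF-fuel (π₂<fuel d≤m m<f) (π₂<fuel d≤m m<g))
  ... | 4 | d | d≤m = cong mu (decodeF-fuel (≤-<-trans d≤m m<f) (≤-<-trans d≤m m<g))
  ... | suc (suc (suc (suc (suc _)))) | _ | _ = refl

  decodeLF-fuel : ∀ {f g x} → x < f → x < g → decodeLF f x ≡ decodeLF g x
  decodeLF-fuel {suc f} {suc g} {zero} _ _ = refl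
  decodeLF-fuel {suc f} {suc g} {suc m} (s≤s m<f) (s≤s m<g) =
    cong₂ _∷_ (decodeF-fuel (π₁<fuel ≤-refl m<f) (π₁<fuel ≤-refl m<g))
              (decodeLF-fuel (π₂<fuel ≤-refl m<f) (π₂<fuel ≤-refl m<g))

mutual
  encode : Code → ℕ
  encode zer         = 0
  encode sucC        = tagged 0 0
  encode (proj i)    = tagged 1 i
  encode (comp c cs) = tagged 2 (pair (encode c) (encodeL cs))
  encode (prec c d)  = tagged 3 (pair (encode c) (encode d))
  encode (mu c)      = tagged 4 (encode c)

  encodeL : List Code → ℕ
  encodeL []       = 0
  encodeL (c ∷ cs) = suc (pair (encode c) (encodeL cs))

mutual
  decodeF-encode : ∀ c {f} → encode c < f → decodeF f (encode c) ≡ c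
  decodeF-encode zer {suc f} _ = refl
  decodeF-encode sucC {suc f} _ = refl
  decodeF-encode (proj i) {suc f} _ = decodeF-proj f i
  decodeF-encode (comp c cs) {suc f} lt = trans (decodeF-comp f (encode c) (encodeL cs))
    (cong₂ comp (decodeF-encode c (payload<fuel 2 (a≤pair[a,b] (encode c) (encodeL cs)) lt))
                (decodeLF-encodeL cs (payload<fuel 2 (b≤pair[a,b] (encode c) (encodeL cs)) lt)))
  decodeF-encode (prec c d) {suc f} lt = trans (decodeF-prec f (encode c) (encode d))
    (cong₂ prec (decodeF-encode c (payload<fuel 3 (a≤pair[a,b] (encode c) (encode d)) lt))
                (decodeF-encode d (payload<fuel 3 (b≤pair[a,b] (encode c) (encode d)) lt)))
  decodeF-encode (mu c) {suc f} lt =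
    trans (decodeF-mu f (encode c)) (cong mu (decodeF-encode c (payload<fuel 4 ≤-refl lt)))

  decodeLF-encodeL : ∀ cs {f} → encodeL cs < f → decodeLF f (encodeL cs) ≡ cs
  decodeLF-encodeL [] {suc f} _ = refl
  decodeLF-encodeL (c ∷ cs) {suc f} (s≤s lt) = trans (decodeLF-cons f (encode c) (encodeL cs))
    (cong₂ _∷_ (decodeF-encode c (≤-<-trans (a≤pair[a,b] (encode c) (encodeL cs)) lt))
               (decodeLF-encodeL cs (≤-<-trans (b≤pair[a,b] (encode c) (encodeL cs)) lt)))

decode-encode : ∀ c → decode (encode c) ≡ c
decode-encode c = decodeF-encode c ≤-refl

app1 : Code → Code → Code
app1 F c = comp F (c ∷ [])

app2 : Code → Code → Code → Code
app2 F c d = comp F (c ∷ d ∷ [])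

eval-app1 : ∀ {F c xs a r} → Eval F (a ∷ []) r → Eval c xs a → Eval (app1 F c) xs r
eval-app1 eF ec = ecomp (ec ∷ []) eF

eval-app2 : ∀ {F c d xs a b r} →
            Eval F (a ∷ b ∷ []) r → Eval c xs a → Eval d xs b → Eval (app2 F c d) xs r
eval-app2 eF ec ed = ecomp (ec ∷ ed ∷ []) eF

app1-inverse : ∀ {F c xs r} → Eval (app1 F c) xs r →
               ∃ λ a → Eval c xs a × Eval F (a ∷ []) r
app1-inverse (ecomp (ec ∷ []) eF) = _ , ec , eF

constC : ℕ → Code
constC zero    = zer
constC (suc n) = app1 sucC (constC n)

eval-constC : ∀ n xs → Eval (constC n) xs n
eval-constC zero    xs = ezer xs
eval-constC (suc n) xs = eval-app1 (esuc _) (eval-constC n xs)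

addC : Code
addC = prec (proj 0) (app1 sucC (proj 1))

eval-addC : ∀ m n → Eval addC (m ∷ n ∷ []) (m + n)
eval-addC zero    n = eprec0 refl (eproj 0 (n ∷ []))
eval-addC (suc m) n = eprecS refl (eval-addC m n) (eval-app1 (esuc _) (eproj 1 _))

mulC : Code
mulC = prec zer (app2 addC (proj 2) (proj 1))

eval-mulC : ∀ m n → Eval mulC (m ∷ n ∷ []) (m * n)
eval-mulC zero    n = eprec0 refl (ezer _)
eval-mulC (suc m) n =
  eprecS refl (eval-mulC m n) (eval-app2 (eval-addC n (m * n)) (eproj 2 _) (eproj 1 _))

triC : Code
triC = prec zer (app2 addC (app1 sucC (proj 0)) (proj 1))

eval-triC : ∀ n → Eval triC (n ∷ []) (tri n)
eval-triC zero    = eprec0 refl (ezer _)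
eval-triC (suc n) =
  eprecS refl (eval-triC n)
    (eval-app2 (eval-addC (suc n) (tri n)) (eval-app1 (esuc _) (eproj 0 _)) (eproj 1 _))

pairC : Code
pairC = app2 addC (app1 triC (app2 addC (proj 0) (proj 1))) (proj 1)

eval-pairC : ∀ a b → Eval pairC (a ∷ b ∷ []) (pair a b)
eval-pairC a b = eval-app2 (eval-addC (tri (a + b)) b)
  (eval-app1 (eval-triC (a + b)) (eval-app2 (eval-addC a b) (eproj 0 _) (eproj 1 _))) (eproj 1 _)

taggedC : ℕ → Code → Code
taggedC k c = app1 sucC (app2 addC (constC k) (app2 mulC c (constC 6)))

eval-taggedC : ∀ k {c xs p} → Eval c xs p → Eval (taggedC k c) xs (tagged k p)
eval-taggedC k {p = p} ec = eval-app1 (esuc _)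
  (eval-app2 (eval-addC k (p * 6)) (eval-constC k _)
             (eval-app2 (eval-mulC p 6) ec (eval-constC 6 _)))

tupleC : ∀ {n} → Vec Code n → Code
tupleC []           = zer
tupleC (c ∷ [])     = c
tupleC (c ∷ d ∷ cs) = app2 pairC c (tupleC (d ∷ cs))

eval-tupleC-map : ∀ {A : Set} {n xs} (code : A → Code) (value : A → ℕ) →
                  (∀ a → Eval (code a) xs (value a)) →
                  (as : Vec A n) → Eval (tupleC (map code as)) xs (tuple (map value as))
eval-tupleC-map code value eval []           = ezer _
eval-tupleC-map code value eval (a ∷ [])     = eval a
eval-tupleC-map code value eval (a ∷ b ∷ as) =
  eval-app2 (eval-pairC _ _) (eval a) (eval-tupleC-map code value eval (b ∷ as))

curryC : ℕ → ℕ → Code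
curryC e a = app1 (decode e) (app2 pairC (constC a) (proj 0))

eval-curryC : ∀ {F : ℕ → ℕ → ℕ} e → (∀ n → e ⟦ n ⟧↓ F (π₁ n) (π₂ n)) →
              ∀ a y → Eval (curryC e a) (y ∷ []) (F a y)
eval-curryC {F} e φₑ a y =
  eval-app1 φₑ⟨a,y⟩ (eval-app2 (eval-pairC a y) (eval-constC a _) (eproj 0 _))
  where
  φₑ⟨a,y⟩ : e ⟦ pair a y ⟧↓ F a y
  φₑ⟨a,y⟩ = subst₂ (λ a′ y′ → e ⟦ pair a y ⟧↓ F a′ y′) (π₁-pair a y) (π₂-pair a y) (φₑ (pair a y))

code⇒Computable : ∀ c {f} → (∀ x → Eval c (x ∷ []) (f x)) → Computable f
code⇒Computable c {f} eval-c =
  encode c , λ x → subst (λ d → Eval d (x ∷ []) (f x)) (sym (decode-encode c)) (eval-c x)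

precompose : Code → ℕ → ℕ
precompose c i = tagged 2 (pair i (encodeL (c ∷ [])))

precomposeC : Code → Code
precomposeC c = taggedC 2 (app2 pairC (proj 0) (constC (encodeL (c ∷ []))))

eval-precomposeC : ∀ c i → Eval (precomposeC c) (i ∷ []) (precompose c i)
eval-precomposeC c i = eval-taggedC 2 (eval-app2 (eval-pairC i _) (eproj 0 _) (eval-constC _ _))

decode-precompose : ∀ c i → decode (precompose c i) ≡ comp (decode i) (c ∷ [])
decode-precompose c i = trans (decodeF-comp (precompose c i) i ℓ)
  (cong₂ comp (decodeF-fuel (payload<fuel 2 (a≤pair[a,b] i ℓ) ≤-refl) ≤-refl)
              (decodeLF-encodeL (c ∷ []) (payload<fuel 2 (b≤pair[a,b] i ℓ) ≤-refl)))
  where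
  ℓ : ℕ
  ℓ = encodeL (c ∷ [])

W-precompose : ∀ {c φ} → (∀ y → Eval c (y ∷ []) (φ y)) →
               ∀ i → W (precompose c i) ≐ (W i ∘ φ)
W-precompose {c} {φ} eval-c i y = to , from
  where
  to : W (precompose c i) y → W i (φ y)
  to (z , ev) with app1-inverse (subst (λ d → Eval d (y ∷ []) z) (decode-precompose c i) ev)
  ... | a , c[y]≡a , φᵢ[a]≡z rewrite Eval-deterministic c[y]≡a (eval-c y) = z , φᵢ[a]≡z

  from : W i (φ y) → W (precompose c i) y
  from (z , φᵢ[φy]≡z) = z , subst (λ d → Eval d (y ∷ []) z) (sym (decode-precompose c i))
                                 (eval-app1 φᵢ[φy]≡z (eval-c y))

≐-isEquivalence : IsEquivalence _≐_
≐-isEquivalence = record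
  { refl  = λ _ → id , id
  ; sym   = λ A≐B x → swap (A≐B x)
  ; trans = λ A≐B B≐C x → proj₁ (B≐C x) ∘ proj₁ (A≐B x)
                         , proj₂ (A≐B x) ∘ proj₂ (B≐C x)
  }

≐-setoid : Setoid (lsuc 0ℓ) 0ℓ
≐-setoid = record { isEquivalence = ≐-isEquivalence }

module ≐-Reasoning = SetoidReasoning ≐-setoid

module _ (G : CompGroupAction) where

  mul≡one⇒act∘act≡id : ∀ {g h} → D G g ≡ true → D G h ≡ true → mul G g h ≡ one G →
                       ∀ x → act G g (act G h x) ≡ x
  mul≡one⇒act∘act≡id {g} {h} Dg Dh gh≡1 x = begin
    act G g (act G h x)  ≡⟨ act-mul G g h x Dg Dh ⟨
    act G (mul G g h) x  ≡⟨ cong (λ k → act G k x) gh≡1 ⟩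
    act G (one G) x      ≡⟨ act-one G x ⟩
    x                    ∎
    where open ≡-Reasoning

  image-cong : ∀ {g A B} → A ≐ B → image G g A ≐ image G g B
  image-cong A≐B y = (λ (x , a , gx≡y) → x , proj₁ (A≐B x) a , gx≡y)
                   , (λ (x , b , gx≡y) → x , proj₂ (A≐B x) b , gx≡y)

  image-≗ : ∀ {g h A} → act G g ≗ act G h → image G g A ≐ image G h A
  image-≗ g≗h y = (λ (x , a , gx≡y) → x , a , trans (sym (g≗h x)) gx≡y)
                , (λ (x , a , hx≡y) → x , a , trans (g≗h x) hx≡y)

  image-mul : ∀ {g h A} → D G g ≡ true → D G h ≡ true →
              image G g (image G h A) ≐ image G (mul G g h) A
  image-mul {g} {h} Dg Dh y =
    (λ (_ , (x , a , hx≡x′) , gx′≡y) →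
       x , a , trans (act-mul G g h x Dg Dh) (trans (cong (act G g) hx≡x′) gx′≡y)) ,
    (λ (x , a , ghx≡y) → act G h x , (x , a , refl) , trans (sym (act-mul G g h x Dg Dh)) ghx≡y)

  image-one : ∀ {A} → image G (one G) A ≐ A
  image-one {A} y = (λ (x , a , 1x≡y) → subst A (trans (sym (act-one G x)) 1x≡y) a)
                  , (λ a → y , a , act-one G y)

  image-as-preimage : ∀ {h A} → D G h ≡ true → image G h A ≐ (A ∘ act G (inv G h))
  image-as-preimage {h} {A} Dh y =
    (λ (x , a , hx≡y) → subst A (trans (sym (h⁻¹h≗id x)) (cong (act G (inv G h)) hx≡y)) a) ,
    (λ a → act G (inv G h) y , a , mul≡one⇒act∘act≡id Dh Dh⁻¹ (invʳ G h Dh) y)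
    where
    Dh⁻¹ : D G (inv G h) ≡ true
    Dh⁻¹ = inv-D G h Dh
    h⁻¹h≗id : ∀ x → act G (inv G h) (act G h x) ≡ x
    h⁻¹h≗id = mul≡one⇒act∘act≡id Dh⁻¹ Dh (invˡ G h Dh)

  ≐image⇒≐inv-image : ∀ {γ A B} → D G γ ≡ true → A ≐ image G γ B → B ≐ image G (inv G γ) A
  ≐image⇒≐inv-image {γ} {A} {B} Dγ A≐γB = begin
    B                                ≈⟨ image-one ⟨
    image G (one G) B                ≈⟨ image-≗ (λ x → cong (λ g → act G g x) (invˡ G γ Dγ)) ⟨
    image G (mul G (inv G γ) γ) B    ≈⟨ image-mul (inv-D G γ Dγ) Dγ ⟨
    image G (inv G γ) (image G γ B)  ≈⟨ image-cong A≐γB ⟨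
    image G (inv G γ) A              ∎
    where open ≐-Reasoning

module Reduction (G : CompGroupAction) (L : List ℕ) (L⊆D : List.All (λ h → D G h ≡ true) L)
                 (L-covers : ∀ g → D G g ≡ true → List.Any (λ h → act G g ≗ act G h) L) where

  open ≐-Reasoning

  n : ℕ
  n = suc (length L)

  reps : Vec ℕ n
  reps = one G ∷ fromList L

  D-reps : ∀ k → D G (lookup reps k) ≡ true
  D-reps = All.lookup⁺ (one-D G ∷ All.fromList⁺ L⊆D)

  reps-cover : ∀ g → D G g ≡ true → ∃ λ k → act G g ≗ act G (lookup reps k)
  reps-cover g Dg = Any.index g∈reps , Any.lookup-index g∈reps
    where
    g∈reps : Any.Any (λ h → act G g ≗ act G h) reps
    g∈reps = Any.there (Any.fromList⁺ (L-covers g Dg))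

  act-index : ℕ
  act-index = proj₁ (act-comp G)

  inverse-actionC : ℕ → Code
  inverse-actionC h = curryC act-index (inv G h)

  eval-inverse-actionC : ∀ h y → Eval (inverse-actionC h) (y ∷ []) (act G (inv G h) y)
  eval-inverse-actionC h = eval-curryC {act G} act-index (proj₂ (act-comp G)) (inv G h)

  translate : ℕ → ℕ → ℕ
  translate h = precompose (inverse-actionC h)

  W-translate : ∀ {h} → D G h ≡ true → ∀ i → W (translate h i) ≐ image G h (W i)
  W-translate {h} Dh i = begin
    W (translate h i)      ≈⟨ W-precompose (eval-inverse-actionC h) i ⟩
    W i ∘ act G (inv G h)  ≈⟨ image-as-preimage G Dh ⟨
    image G h (W i)        ∎

  translates : ℕ → Vec ℕ n
  translates i = map (λ h → translate h i) reps

  reduction : ℕ → ℕ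
  reduction i = tuple (translates i)

  reduction-computable : Computable reduction
  reduction-computable = code⇒Computable (tupleC (map translateC reps)) λ i →
    eval-tupleC-map translateC (λ h → translate h i)
                    (λ h → eval-precomposeC (inverse-actionC h) i) reps
    where
    translateC : ℕ → Code
    translateC = precomposeC ∘ inverse-actionC

  component : ℕ → Fin n → ℕ
  component i k = lookup (unpairN n (reduction i)) k

  W-component : ∀ i k → W (component i k) ≐ image G (lookup reps k) (W i)
  W-component i k = begin
    W (component i k)                ≡⟨ cong W (lookup-unpairN-tuple (translates i) k) ⟩
    W (lookup (translates i) k)      ≡⟨ cong W (lookup-map k (λ h → translate h i) reps) ⟩
    W (translate (lookup reps k) i)  ≈⟨ W-translate (D-reps k) i ⟩
    image G (lookup reps k) (W i)    ∎

  matching-component : ∀ {γ} i j → D G γ ≡ true → W i ≐ image G γ (W j) →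
                       ∀ k → ∃ λ l → W (component i k) ≐ W (component j l)
  matching-component {γ} i j Dγ Wi≐γWj k =
    let h = lookup reps k
        l , hγ≗reps[l] = reps-cover (mul G h γ) (mul-D G h γ (D-reps k) Dγ)
    in l , (begin
      W (component i k)              ≈⟨ W-component i k ⟩
      image G h (W i)                ≈⟨ image-cong G Wi≐γWj ⟩
      image G h (image G γ (W j))    ≈⟨ image-mul G (D-reps k) Dγ ⟩
      image G (mul G h γ) (W j)      ≈⟨ image-≗ G hγ≗reps[l] ⟩
      image G (lookup reps l) (W j)  ≈⟨ W-component j l ⟨
      W (component j l)              ∎)

  Rce⇒Eset : ∀ i j → Rce G i j → Eset n (reduction i) (reduction j)
  Rce⇒Eset i j (γ , Dγ , Wi≐γWj) =
    matching-component i j Dγ Wi≐γWj ,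
    matching-component j i (inv-D G γ Dγ) (≐image⇒≐inv-image G Dγ Wi≐γWj)

  Eset⇒Rce : ∀ i j → Eset n (reduction i) (reduction j) → Rce G i j
  Eset⇒Rce i j (i⊆j , _) =
    let l , W₀≐Wₗ = i⊆j zero
    in lookup reps l , D-reps l , (begin
      W i                            ≈⟨ image-one G ⟨
      image G (one G) (W i)          ≈⟨ W-component i zero ⟨
      W (component i zero)           ≈⟨ W₀≐Wₗ ⟩
      W (component j l)              ≈⟨ W-component j l ⟩
      image G (lookup reps l) (W j)  ∎)

lemma3p3 : (G : CompGroupAction) → FinitelyManyActions G → ∃ λ (n : ℕ) → Rce G ≤c Eset n
lemma3p3 G (L , L⊆D , L-covers) =
  n , reduction , reduction-computable , λ i j → Rce⇒Eset i j , Eset⇒Rce i j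
  where open Reduction G L L⊆D L-covers
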